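{- Let $R(n)$ be the number of partitions $\lambda\vdash n$ such that $P(B(\lambda)^r)$ is also a partition of $n$. Then, as formal power series in $q$, $$\sum_{n=0}^{\infty}R(n)q^n=\sum_{k=0}^{\infty}\sum_{l=0}^{\infty}T(2l,k)q^{2kl+2k+2l+1} + 2\sum_{k=0}^{\infty}\sum_{l=0}^{\infty}T(2k+1,l)q^{2kl+2k+3l+2}.$$
   Context: For a partition $\lambda$ (of a positive integer) with $\lambda_1$ columns and $\ell$ nonzero rows, the southeast boundary of its Young diagram is a lattice path from the bottom-left to the top-right corner with $\lambda_1$ right steps and $\ell$ up steps, the first step right and the last step up. Writing $1$ for each right step and $0$ for each up step, read southwest to northeast, and deleting the first entry (a $1$) and last entry (a $0$), gives the binary sequence $B(\lambda)$. This is a bijection from partitions of positive integers to finite binary sequences; $P(C)$ denotes the partition with $B(P(C))=C$, and $C^r$ denotes the reverse of $C$. $R(0)=0$. $T(n,k)$ denotes the number of nondecreasing sequences of length $n$ with integer entries in $[-k,k]$ summing to zero. -}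

module Defs where

open import Data.Bool using (Bool; true; false; _∧_; if_then_else_)
open import Data.Nat as ℕ using (ℕ; zero; suc; _+_; _*_; _∸_; _⊓_)
open import Data.Integer as ℤ using (ℤ; +_; -_)
open import Data.List using (List; []; _∷_; _++_; [_]; map; concatMap; reverse; length; drop; take; replicate; filterᵇ; upTo; foldr)
open import Data.Nat.ListAction using (sum)
open import Relation.Nullary using (does)

-- Partitions: a partition is a nonincreasing list of positive naturals.
-- partsLE fuel n m : all partitions of n with all parts ≤ m
-- (fuel ≥ n guarantees completeness; we always use fuel = n).

partsLE : ℕ → ℕ → ℕ → List (List ℕ)
partsLE _        zero    _ = [] ∷ []
partsLE zero     (suc n) _ = []
partsLE (suc f) (suc n) m =
  concatMap (λ k → map (suc k ∷_) (partsLE f (suc n ∸ suc k) (suc k)))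
            (upTo (suc n ⊓ m))

partitions : ℕ → List (List ℕ)
partitions n = partsLE n n n

size : List ℕ → ℕ
size = sum

-- Southeast boundary path, read southwest to northeast
-- (true = right step = 1, false = up step = 0).
-- The argument is the list of parts in increasing order (bottom row first),
-- `prev` is the length of the row below.

pathFrom : ℕ → List ℕ → List Bool
pathFrom prev []       = []
pathFrom prev (x ∷ xs) = replicate (x ∸ prev) true ++ false ∷ pathFrom x xs

boundary : List ℕ → List Bool
boundary λ′ = pathFrom 0 (reverse λ′)

B : List ℕ → List Bool
B λ′ = let w = drop 1 (boundary λ′) in take (length w ∸ 1) w

-- P(C): the partition whose boundary word is 1 C 0.
-- Each up step (0) closes a row whose length is the number of
-- right steps (1s) before it; rows are produced bottom to top.
rowsOf : ℕ → List Bool → List ℕ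
rowsOf c []           = []
rowsOf c (true ∷ xs)  = rowsOf (suc c) xs
rowsOf c (false ∷ xs) = c ∷ rowsOf c xs

P : List Bool → List ℕ
P C = reverse (rowsOf 0 (true ∷ C ++ false ∷ []))

R : ℕ → ℕ
R zero    = 0
R (suc n) = length (filterᵇ (λ λ′ → does (size (P (reverse (B λ′))) ℕ.≟ suc n))
                            (partitions (suc n)))

interval : ℕ → List ℤ
interval k = map (λ i → (+ i) ℤ.- (+ k)) (upTo (suc (k + k)))

seqs : ℕ → ℕ → List (List ℤ)
seqs zero    k = [] ∷ []
seqs (suc n) k = concatMap (λ x → map (x ∷_) (seqs n k)) (interval k)

nondecᵇ : List ℤ → Bool
nondecᵇ []           = true
nondecᵇ (x ∷ [])     = true
nondecᵇ (x ∷ y ∷ xs) = does (x ℤ.≤? y) ∧ nondecᵇ (y ∷ xs)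

sumℤ : List ℤ → ℤ
sumℤ = foldr ℤ._+_ (+ 0)

T : ℕ → ℕ → ℕ
T n k = length (filterᵇ (λ xs → nondecᵇ xs ∧ does (sumℤ xs ℤ.≟ + 0)) (seqs n k))

-- Coefficient of q^n in the right-hand side.
-- Every exponent is ≥ k + l + 1, so only k, l ≤ n contribute; the finite
-- double sums over k, l ∈ [0, n] give the exact coefficient.

Σ≤ : ℕ → (ℕ → ℕ) → ℕ
Σ≤ n f = sum (map f (upTo (suc n)))

term : ℕ → ℕ → ℕ → ℕ
term a n e = if does (e ℕ.≟ n) then a else 0

rhsCoeff : ℕ → ℕ
rhsCoeff n =
    Σ≤ n (λ k → Σ≤ n (λ l → term (T (2 * l) k) n (2 * k * l + 2 * k + 2 * l + 1)))
  + 2 * Σ≤ n (λ k → Σ≤ n (λ l → term (T (2 * k + 1) l) n (2 * k * l + 2 * k + 3 * l + 2)))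

-- Reading 1 for a right step and 0 for an up step, B is a bijection from the partitions of n onto
-- the binary words C with |P(C)| = n, and |P(C)| = inv C + ones C + zeros C + 1, where inv C counts
-- the pairs 1…0 in C. Reversal turns these into the pairs 0…1, and the two kinds of pairs number
-- ones C · zeros C together; so λ is counted by R(n) exactly when C has a ones and b zeros with
-- ab = 2t even, inv C = t and t + a + b + 1 = n. Words with a ones, b zeros and t inversions are
-- counted by a Gaussian coefficient, symmetric in a and b by reversing and complementing. Recording
-- for each 0 the number of 1s before it, shifted by -k, identifies the words with 2k ones, m zeros
-- and mk inversions with the sequences counted by T(m,k). Sorting (a, b) by parity gives the two
-- series: both even gives the first, each mixed case gives the second, and both odd gives nothing.

module Submission where

open import Defs
open import Data.Bool as Bool using (Bool; true; false; _∧_; not; if_then_else_)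
open import Data.Bool.Properties using (∧-identityʳ; ∧-zeroʳ; not-involutive; T?; T-∧)
open import Data.Empty using (⊥-elim)
open import Data.Integer as ℤ using (ℤ)
import Data.Integer.Properties as ℤ
open import Algebra.Properties.CommutativeSemigroup ℤ.+-commutativeSemigroup using (interchange)
open import Data.List
  using (List; []; _∷_; _++_; [_]; map; concatMap; length; filterᵇ; upTo; applyUpTo; reverse; reverseAcc; replicate; take)
open import Data.List.Properties
  using ( ∷-injectiveˡ; ∷-injectiveʳ; length-map; length-++; ++-assoc; ++-identityʳ; map-∘; map-id-local; filter-++
        ; map-applyUpTo; reverse-involutive; reverse-map; unfold-reverse; concatMap-map; concatMap-cong; map-concatMap)
open import Data.List.Membership.Propositional using (_∈_; find; lose)
open import Data.List.Membership.Propositional.Properties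
  using ( ∈-map⁺; ∈-map⁻; ∈-++⁺ˡ; ∈-++⁺ʳ; ∈-++⁻; ∈-filter⁺; ∈-filter⁻
        ; ∈-concatMap⁺; ∈-concatMap⁻; ∈-upTo⁺; ∈-upTo⁻)
open import Data.List.Membership.Propositional.Properties.WithK using (unique∧set⇒bag)
open import Data.List.Relation.Binary.BagAndSetEquality using (∼bag⇒↭)
open import Data.List.Relation.Binary.Permutation.Propositional.Properties using (↭-length; ↭-reverse)
open import Data.List.Relation.Unary.All as All using (All; []; _∷_)
open import Data.List.Relation.Unary.AllPairs using ([]; _∷_)
open import Data.List.Relation.Unary.Any using (here; there)
open import Data.List.Relation.Unary.Unique.Propositional using (Unique)
import Data.List.Relation.Unary.Unique.Propositional.Properties as Unique
open import Data.Nat using (ℕ; zero; suc; _+_; _*_; _∸_; _≤_; _<_; s≤s; z≤n; z<s; _⊓_; _≤ᵇ_)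
open import Data.Nat.Divisibility using (_∣_; ∣1⇒≡1; ∣m+n∣m⇒∣n; m∣m*n)
open import Data.Nat.ListAction using (sum)
open import Data.Nat.ListAction.Properties using (sum-↭)
open import Data.Nat.Properties
open import Data.Nat.Solver using (module +-*-Solver)
open import Data.Product using (∃; _×_; _,_; proj₁; proj₂)
open import Data.Sum using (inj₁; inj₂)
open import Data.Unit using (⊤; tt)
open import Function using (_∘_)
open import Function.Bundles using (Equivalence; mk⇔)
open import Relation.Binary.PropositionalEquality hiding ([_])
open import Relation.Nullary using (does)
open import Relation.Nullary.Decidable using (does-⇔; dec-false; _×-dec_)

open +-*-Solver

private variable X Y : Set

-- Counting through bijections

∈-concatMap⁺′ : {f : X → List Y} {x : X} {y : Y} {xs : List X} →
                x ∈ xs → y ∈ f x → y ∈ concatMap f xs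
∈-concatMap⁺′ {f = f} x∈xs y∈fx = ∈-concatMap⁺ f (lose x∈xs y∈fx)

∈-concatMap⁻′ : (f : X → List Y) (xs : List X) {y : Y} →
                y ∈ concatMap f xs → ∃ λ x → x ∈ xs × y ∈ f x
∈-concatMap⁻′ f xs = find ∘ ∈-concatMap⁻ f

concatMap-unique : (f : X → List Y) {xs : List X} → Unique xs → (∀ x → Unique (f x)) →
                   (∀ {x x′ y} → y ∈ f x → y ∈ f x′ → x ≡ x′) → Unique (concatMap f xs)
concatMap-unique f {[]}     _            _      _     = []
concatMap-unique f {x ∷ xs} (x∉xs ∷ !xs) !f disjoint =
  Unique.++⁺ (!f x) (concatMap-unique f !xs !f disjoint) λ (y∈fx , y∈rest) →
    let x′ , x′∈xs , y∈fx′ = ∈-concatMap⁻′ f xs y∈rest in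
    All.lookup x∉xs x′∈xs (disjoint y∈fx y∈fx′)

length-bijection : {xs : List X} {ys : List Y} → Unique xs → Unique ys →
  (f : X → Y) (g : Y → X) →
  (∀ {x} → x ∈ xs → f x ∈ ys × g (f x) ≡ x) →
  (∀ {y} → y ∈ ys → g y ∈ xs × f (g y) ≡ y) →
  length xs ≡ length ys
length-bijection {xs = xs} {ys} !xs !ys f g to from =
  trans (sym (length-map f xs)) (↭-length (∼bag⇒↭ (unique∧set⇒bag !fxs !ys (mk⇔ ⊆ys ⊇ys))))
  where
  !fxs : Unique (map f xs)
  !fxs = Unique.map⁻ (subst Unique (sym (trans (sym (map-∘ {g = g} {f = f} xs)) gf≡id)) !xs)
    where
    gf≡id : map (g ∘ f) xs ≡ xs
    gf≡id = map-id-local (All.tabulate (proj₂ ∘ to))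
  ⊆ys : ∀ {z} → z ∈ map f xs → z ∈ ys
  ⊆ys z∈ with x , x∈ , refl ← ∈-map⁻ f z∈ = proj₁ (to x∈)
  ⊇ys : ∀ {z} → z ∈ ys → z ∈ map f xs
  ⊇ys z∈ = subst (_∈ map f xs) (proj₂ (from z∈)) (∈-map⁺ f (proj₁ (from z∈)))

count : (X → Bool) → List X → ℕ
count p xs = length (filterᵇ p xs)

count-bijection : {xs : List X} {ys : List Y} (p : X → Bool) (q : Y → Bool) →
  Unique xs → Unique ys → (f : X → Y) (g : Y → X) →
  (∀ {x} → x ∈ xs → Bool.T (p x) → (f x ∈ ys × Bool.T (q (f x))) × g (f x) ≡ x) →
  (∀ {y} → y ∈ ys → Bool.T (q y) → (g y ∈ xs × Bool.T (p (g y))) × f (g y) ≡ y) →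
  count p xs ≡ count q ys
count-bijection p q !xs !ys f g to from =
  length-bijection (Unique.filter⁺ _ !xs) (Unique.filter⁺ _ !ys) f g
    (λ x∈ → let x∈xs , px = ∈-filter⁻ _ x∈ ; (fx∈ys , qfx) , gfx≡x = to x∈xs px in
            ∈-filter⁺ _ fx∈ys qfx , gfx≡x)
    (λ y∈ → let y∈ys , qy = ∈-filter⁻ _ y∈ ; (gy∈xs , pgy) , fgy≡y = from y∈ys qy in
            ∈-filter⁺ _ gy∈xs pgy , fgy≡y)

count-cong : (p q : X → Bool) (xs : List X) → (∀ {x} → x ∈ xs → p x ≡ q x) → count p xs ≡ count q xs
count-cong p q []       _   = refl
count-cong p q (x ∷ xs) p≡q with p x | q x | p≡q (here refl)
... | true  | true  | refl = cong suc (count-cong p q xs (p≡q ∘ there))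
... | false | false | refl = count-cong p q xs (p≡q ∘ there)

count-false : (xs : List X) → count (λ _ → false) xs ≡ 0
count-false []       = refl
count-false (_ ∷ xs) = count-false xs

count-∧-const : (p : X → Bool) (b : Bool) (xs : List X) →
                count (λ x → p x ∧ b) xs ≡ (if b then count p xs else 0)
count-∧-const p true  xs = count-cong _ _ xs (λ {x} _ → ∧-identityʳ (p x))
count-∧-const p false xs = trans (count-cong _ _ xs (λ {x} _ → ∧-zeroʳ (p x))) (count-false xs)

count-++ : (p : X → Bool) (xs ys : List X) → count p (xs ++ ys) ≡ count p xs + count p ys
count-++ p xs ys = trans (cong length (filter-++ (T? ∘ p) xs ys)) (length-++ (filterᵇ p xs))

count-map : (p : Y → Bool) (h : X → Y) (xs : List X) → count p (map h xs) ≡ count (p ∘ h) xs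
count-map p h []       = refl
count-map p h (x ∷ xs) with p (h x)
... | true  = cong suc (count-map p h xs)
... | false = count-map p h xs

count-concatMap : (p : Y → Bool) (f : X → List Y) (xs : List X) →
                  count p (concatMap f xs) ≡ sum (map (count p ∘ f) xs)
count-concatMap p f []       = refl
count-concatMap p f (x ∷ xs) =
  trans (count-++ p (f x) (concatMap f xs)) (cong (count p (f x) +_) (count-concatMap p f xs))

-- Finite sums

Σ< : ℕ → (ℕ → ℕ) → ℕ
Σ< n f = sum (applyUpTo f n)

Σ≤≡Σ< : ∀ n f → Σ≤ n f ≡ Σ< (suc n) f
Σ≤≡Σ< n f = cong sum (map-applyUpTo (λ i → i) f (suc n))

count-concatMap-upTo : (p : Y → Bool) (f : ℕ → List Y) (n : ℕ) →
                       count p (concatMap f (upTo n)) ≡ Σ< n (count p ∘ f)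
count-concatMap-upTo p f n =
  trans (count-concatMap p f (upTo n)) (cong sum (map-applyUpTo (λ i → i) (count p ∘ f) n))

Σ<-cong : ∀ n {f g : ℕ → ℕ} → (∀ i → f i ≡ g i) → Σ< n f ≡ Σ< n g
Σ<-cong zero    f≡g = refl
Σ<-cong (suc n) f≡g = cong₂ _+_ (f≡g 0) (Σ<-cong n (f≡g ∘ suc))

Σ<-zero : ∀ n → Σ< n (λ _ → 0) ≡ 0
Σ<-zero zero    = refl
Σ<-zero (suc n) = Σ<-zero n

Σ<-+ : ∀ n (f g : ℕ → ℕ) → Σ< n (λ i → f i + g i) ≡ Σ< n f + Σ< n g
Σ<-+ zero    f g = refl
Σ<-+ (suc n) f g = trans (cong (f 0 + g 0 +_) (Σ<-+ n (f ∘ suc) (g ∘ suc)))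
                         (solve 4 (λ a b c d → (a :+ b) :+ (c :+ d) := (a :+ c) :+ (b :+ d))
                                refl (f 0) (g 0) (Σ< n (f ∘ suc)) (Σ< n (g ∘ suc)))

Σ<-comm : ∀ m n (f : ℕ → ℕ → ℕ) → Σ< m (λ i → Σ< n (f i)) ≡ Σ< n (λ j → Σ< m (λ i → f i j))
Σ<-comm zero    n f = sym (Σ<-zero n)
Σ<-comm (suc m) n f = trans (cong (Σ< n (f 0) +_) (Σ<-comm m n (f ∘ suc)))
                            (sym (Σ<-+ n (f 0) (λ j → Σ< m (λ i → f (suc i) j))))

Σ<-even-odd : ∀ n (f : ℕ → ℕ) → Σ< (2 * n) f ≡ Σ< n (λ k → f (2 * k) + f (2 * k + 1))
Σ<-even-odd zero    f = refl
Σ<-even-odd (suc n) f = begin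
  Σ< (2 * suc n) f                                ≡⟨ cong (λ m → Σ< m f) (*-suc 2 n) ⟩
  f 0 + (f 1 + Σ< (2 * n) (f ∘ suc ∘ suc))        ≡⟨ +-assoc (f 0) (f 1) _ ⟨
  f 0 + f 1 + Σ< (2 * n) (f ∘ suc ∘ suc)          ≡⟨ cong (f 0 + f 1 +_) (Σ<-even-odd n (f ∘ suc ∘ suc)) ⟩
  f 0 + f 1 + Σ< n (λ k → f (2 + 2 * k) + f (2 + 2 * k + 1))
    ≡⟨ cong (f 0 + f 1 +_) (Σ<-cong n λ k → cong (λ j → f j + f (j + 1)) (*-suc 2 k)) ⟨
  Σ< (suc n) (λ k → f (2 * k) + f (2 * k + 1))    ∎
  where open ≡-Reasoning

Σ<-even-odd² : ∀ n (f : ℕ → ℕ → ℕ) →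
  Σ< (2 * n) (λ a → Σ< (2 * n) (f a)) ≡
  Σ< n (λ k → Σ< n (λ l → f (2 * k) (2 * l) + f (2 * k) (2 * l + 1))
            + Σ< n (λ l → f (2 * k + 1) (2 * l) + f (2 * k + 1) (2 * l + 1)))
Σ<-even-odd² n f = trans (Σ<-even-odd n (λ a → Σ< (2 * n) (f a)))
  (Σ<-cong n λ k → cong₂ _+_ (Σ<-even-odd n (f (2 * k))) (Σ<-even-odd n (f (2 * k + 1))))

Σ<-collect : ∀ n (A B : ℕ → ℕ → ℕ) →
  Σ< n (λ k → Σ< n (λ l → A k l + B l k) + Σ< n (B k)) ≡
  Σ< n (λ k → Σ< n (A k)) + 2 * Σ< n (λ k → Σ< n (B k))
Σ<-collect n A B = begin
  Σ< n (λ k → Σ< n (λ l → A k l + B l k) + Σ< n (B k))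
    ≡⟨ Σ<-cong n (λ k → cong (_+ Σ< n (B k)) (Σ<-+ n (A k) (λ l → B l k))) ⟩
  Σ< n (λ k → Σ< n (A k) + Σ< n (λ l → B l k) + Σ< n (B k))
    ≡⟨ Σ<-+ n _ _ ⟩
  Σ< n (λ k → Σ< n (A k) + Σ< n (λ l → B l k)) + ΣΣB
    ≡⟨ cong (_+ ΣΣB) (Σ<-+ n _ _) ⟩
  ΣΣA + Σ< n (λ k → Σ< n (λ l → B l k)) + ΣΣB
    ≡⟨ cong (λ s → ΣΣA + s + ΣΣB) (Σ<-comm n n (λ k l → B l k)) ⟩
  ΣΣA + ΣΣB + ΣΣB
    ≡⟨ solve 2 (λ a b → a :+ b :+ b := a :+ con 2 :* b) refl ΣΣA ΣΣB ⟩
  ΣΣA + 2 * ΣΣB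
    ∎
  where
  open ≡-Reasoning
  ΣΣA = Σ< n (λ k → Σ< n (A k))
  ΣΣB = Σ< n (λ k → Σ< n (B k))

-- Binary words, inversions and Gaussian coefficients

ones zeros : List Bool → ℕ
ones  []           = 0
ones  (true  ∷ xs) = suc (ones xs)
ones  (false ∷ xs) = ones xs
zeros []           = 0
zeros (true  ∷ xs) = zeros xs
zeros (false ∷ xs) = suc (zeros xs)

inv coinv : List Bool → ℕ
inv   []           = 0
inv   (true  ∷ xs) = zeros xs + inv xs
inv   (false ∷ xs) = inv xs
coinv []           = 0
coinv (true  ∷ xs) = coinv xs
coinv (false ∷ xs) = ones xs + coinv xs

ones-++ : ∀ xs ys → ones (xs ++ ys) ≡ ones xs + ones ys
ones-++ []           ys = refl
ones-++ (true  ∷ xs) ys = cong suc (ones-++ xs ys)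
ones-++ (false ∷ xs) ys = ones-++ xs ys

zeros-++ : ∀ xs ys → zeros (xs ++ ys) ≡ zeros xs + zeros ys
zeros-++ []           ys = refl
zeros-++ (true  ∷ xs) ys = zeros-++ xs ys
zeros-++ (false ∷ xs) ys = cong suc (zeros-++ xs ys)

inv-++ : ∀ xs ys → inv (xs ++ ys) ≡ inv xs + ones xs * zeros ys + inv ys
inv-++ []           ys = refl
inv-++ (true  ∷ xs) ys rewrite zeros-++ xs ys | inv-++ xs ys =
  solve 5 (λ z z′ i o i′ → z :+ z′ :+ (i :+ o :* z′ :+ i′) := z :+ i :+ (z′ :+ o :* z′) :+ i′)
        refl (zeros xs) (zeros ys) (inv xs) (ones xs) (inv ys)
inv-++ (false ∷ xs) ys = inv-++ xs ys

inv+coinv : ∀ xs → inv xs + coinv xs ≡ ones xs * zeros xs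
inv+coinv []           = refl
inv+coinv (true  ∷ xs) = trans (+-assoc (zeros xs) (inv xs) (coinv xs)) (cong (zeros xs +_) (inv+coinv xs))
inv+coinv (false ∷ xs) = begin
  inv xs + (ones xs + coinv xs)  ≡⟨ solve 3 (λ i o c → i :+ (o :+ c) := o :+ (i :+ c)) refl (inv xs) (ones xs) _ ⟩
  ones xs + (inv xs + coinv xs)  ≡⟨ cong (ones xs +_) (inv+coinv xs) ⟩
  ones xs + ones xs * zeros xs   ≡⟨ *-suc (ones xs) (zeros xs) ⟨
  ones xs * suc (zeros xs)       ∎
  where open ≡-Reasoning

ones-reverse : ∀ xs → ones (reverse xs) ≡ ones xs
ones-reverse []       = refl
ones-reverse (x ∷ xs) rewrite unfold-reverse x xs | ones-++ (reverse xs) [ x ] | ones-reverse xs with x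
... | true  = +-comm (ones xs) 1
... | false = +-identityʳ (ones xs)

zeros-reverse : ∀ xs → zeros (reverse xs) ≡ zeros xs
zeros-reverse []       = refl
zeros-reverse (x ∷ xs) rewrite unfold-reverse x xs | zeros-++ (reverse xs) [ x ] | zeros-reverse xs with x
... | true  = +-identityʳ (zeros xs)
... | false = +-comm (zeros xs) 1

inv-reverse : ∀ xs → inv (reverse xs) ≡ coinv xs
inv-reverse []       = refl
inv-reverse (x ∷ xs) rewrite unfold-reverse x xs | inv-++ (reverse xs) [ x ]
                           | inv-reverse xs | ones-reverse xs with x
... | true  = solve 2 (λ c o → c :+ o :* con 0 :+ con 0 := c) refl (coinv xs) (ones xs)
... | false = solve 2 (λ c o → c :+ o :* con 1 :+ con 0 := o :+ c) refl (coinv xs) (ones xs)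

ones-map-not : ∀ xs → ones (map not xs) ≡ zeros xs
ones-map-not []           = refl
ones-map-not (true  ∷ xs) = ones-map-not xs
ones-map-not (false ∷ xs) = cong suc (ones-map-not xs)

zeros-map-not : ∀ xs → zeros (map not xs) ≡ ones xs
zeros-map-not []           = refl
zeros-map-not (true  ∷ xs) = cong suc (zeros-map-not xs)
zeros-map-not (false ∷ xs) = zeros-map-not xs

coinv-map-not : ∀ xs → coinv (map not xs) ≡ inv xs
coinv-map-not []           = refl
coinv-map-not (true  ∷ xs) = cong₂ _+_ (ones-map-not xs) (coinv-map-not xs)
coinv-map-not (false ∷ xs) = coinv-map-not xs

reverseComplement : List Bool → List Bool
reverseComplement = reverse ∘ map not

reverseComplement-involutive : ∀ xs → reverseComplement (reverseComplement xs) ≡ xs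
reverseComplement-involutive xs = begin
  reverse (map not (reverse (map not xs)))  ≡⟨ cong reverse (reverse-map not (map not xs)) ⟩
  reverse (reverse (map not (map not xs)))  ≡⟨ reverse-involutive _ ⟩
  map not (map not xs)                      ≡⟨ map-∘ xs ⟨
  map (not ∘ not) xs                        ≡⟨ map-id-local (All.tabulate λ {x} _ → not-involutive x) ⟩
  xs                                        ∎
  where open ≡-Reasoning

ones-reverseComplement : ∀ xs → ones (reverseComplement xs) ≡ zeros xs
ones-reverseComplement xs = trans (ones-reverse (map not xs)) (ones-map-not xs)

zeros-reverseComplement : ∀ xs → zeros (reverseComplement xs) ≡ ones xs
zeros-reverseComplement xs = trans (zeros-reverse (map not xs)) (zeros-map-not xs)

inv-reverseComplement : ∀ xs → inv (reverseComplement xs) ≡ inv xs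
inv-reverseComplement xs = trans (inv-reverse (map not xs)) (coinv-map-not xs)

words : ℕ → ℕ → List (List Bool)
words zero    zero    = [ [] ]
words (suc a) zero    = map (true ∷_) (words a zero)
words zero    (suc b) = map (false ∷_) (words zero b)
words (suc a) (suc b) = map (true ∷_) (words a (suc b)) ++ map (false ∷_) (words (suc a) b)

private
  ∈-map-∷⁻ : ∀ {x : Bool} {xs : List Bool} {L} → xs ∈ map (x ∷_) L → ∃ λ ys → xs ≡ x ∷ ys × ys ∈ L
  ∈-map-∷⁻ xs∈ with ys , ys∈ , eq ← ∈-map⁻ _ xs∈ = ys , eq , ys∈

words-sound : ∀ a b {xs} → xs ∈ words a b → ones xs ≡ a × zeros xs ≡ b
words-sound zero    zero    (here refl) = refl , refl
words-sound (suc a) zero    xs∈ with _ , refl , ys∈ ← ∈-map-∷⁻ xs∈ =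
  let o , z = words-sound a zero ys∈ in cong suc o , z
words-sound zero    (suc b) xs∈ with _ , refl , ys∈ ← ∈-map-∷⁻ xs∈ =
  let o , z = words-sound zero b ys∈ in o , cong suc z
words-sound (suc a) (suc b) xs∈ with ∈-++⁻ (map (true ∷_) (words a (suc b))) xs∈
... | inj₁ xs∈₁ with _ , refl , ys∈ ← ∈-map-∷⁻ xs∈₁ =
  let o , z = words-sound a (suc b) ys∈ in cong suc o , z
... | inj₂ xs∈₂ with _ , refl , ys∈ ← ∈-map-∷⁻ xs∈₂ =
  let o , z = words-sound (suc a) b ys∈ in o , cong suc z

∈-words : ∀ xs → xs ∈ words (ones xs) (zeros xs)
∈-words []           = here refl
∈-words (true  ∷ xs) with zeros xs | ∈-words xs
... | zero   | xs∈ = ∈-map⁺ (true ∷_) xs∈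
... | suc _  | xs∈ = ∈-++⁺ˡ (∈-map⁺ (true ∷_) xs∈)
∈-words (false ∷ xs) with ones xs | ∈-words xs
... | zero   | xs∈ = ∈-map⁺ (false ∷_) xs∈
... | suc o  | xs∈ = ∈-++⁺ʳ (map (true ∷_) (words o (suc (zeros xs)))) (∈-map⁺ (false ∷_) xs∈)

∈-words′ : ∀ {a b} xs → ones xs ≡ a → zeros xs ≡ b → xs ∈ words a b
∈-words′ xs refl refl = ∈-words xs

words-unique : ∀ a b → Unique (words a b)
words-unique zero    zero    = [] ∷ []
words-unique (suc a) zero    = Unique.map⁺ ∷-injectiveʳ (words-unique a zero)
words-unique zero    (suc b) = Unique.map⁺ ∷-injectiveʳ (words-unique zero b)
words-unique (suc a) (suc b) =
  Unique.++⁺ (Unique.map⁺ ∷-injectiveʳ (words-unique a (suc b)))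
             (Unique.map⁺ ∷-injectiveʳ (words-unique (suc a) b))
             λ (p , q) → true≢false (let _ , e , _ = ∈-map-∷⁻ p ; _ , e′ , _ = ∈-map-∷⁻ q in
                                     ∷-injectiveˡ (trans (sym e) e′))
  where true≢false : true ≢ false
        true≢false ()

-- The coefficient of q^t in the Gaussian binomial coefficient [a+b choose a]_q.
gaussian : ℕ → ℕ → ℕ → ℕ
gaussian a b t = count (λ xs → does (inv xs ≟ t)) (words a b)

gaussian-sym : ∀ a b t → gaussian a b t ≡ gaussian b a t
gaussian-sym a b t =
  count-bijection _ _ (words-unique a b) (words-unique b a) reverseComplement reverseComplement
    (swap a b) (swap b a)
  where
  swap : ∀ a b {xs} → xs ∈ words a b → Bool.T (does (inv xs ≟ t)) →
         (reverseComplement xs ∈ words b a × Bool.T (does (inv (reverseComplement xs) ≟ t)))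
         × reverseComplement (reverseComplement xs) ≡ xs
  swap a b {xs} xs∈ inv≡t =
    let o , z = words-sound a b xs∈ in
    ( ∈-words′ _ (trans (ones-reverseComplement xs) z) (trans (zeros-reverseComplement xs) o)
    , subst (λ i → Bool.T (does (i ≟ t))) (sym (inv-reverseComplement xs)) inv≡t )
    , reverseComplement-involutive xs

wordsBelow : ℕ → List (List Bool)
wordsBelow N = concatMap (λ a → concatMap (λ b → words a b) (upTo N)) (upTo N)

∈-wordsBelow : ∀ N xs → ones xs < N → zeros xs < N → xs ∈ wordsBelow N
∈-wordsBelow N xs o<N z<N =
  ∈-concatMap⁺′ (∈-upTo⁺ o<N) (∈-concatMap⁺′ (∈-upTo⁺ z<N) (∈-words xs))

wordsBelow-unique : ∀ N → Unique (wordsBelow N)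
wordsBelow-unique N =
  concatMap-unique _ (Unique.upTo⁺ N)
    (λ a → concatMap-unique _ (Unique.upTo⁺ N) (λ b → words-unique a b)
             λ {b} {b′} p q → trans (sym (proj₂ (words-sound a b p))) (proj₂ (words-sound a b′ q)))
    λ {a} {a′} p q → let b , _ , p′ = ∈-concatMap⁻′ (words a) (upTo N) p
                         b′ , _ , q′ = ∈-concatMap⁻′ (words a′) (upTo N) q in
                     trans (sym (proj₁ (words-sound a b p′))) (proj₁ (words-sound a′ b′ q′))

count-wordsBelow : ∀ (p : List Bool → Bool) N →
                   count p (wordsBelow N) ≡ Σ< N (λ a → Σ< N (λ b → count p (words a b)))
count-wordsBelow p N = trans (count-concatMap-upTo p _ N) (Σ<-cong N λ a → count-concatMap-upTo p (words a) N)

-- Partitions and their boundary words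

Ascending : ℕ → List ℕ → Set
Ascending p []       = ⊤
Ascending p (x ∷ xs) = p ≤ x × Ascending x xs

Ascending-weaken : ∀ {p q} xs → p ≤ q → Ascending q xs → Ascending p xs
Ascending-weaken []       _   _               = tt
Ascending-weaken (x ∷ xs) p≤q (q≤x , xs↑) = ≤-trans p≤q q≤x , xs↑

Partition≤ : ℕ → List ℕ → Set
Partition≤ m []       = ⊤
Partition≤ m (x ∷ xs) = 1 ≤ x × x ≤ m × Partition≤ x xs

Partition≤-weaken : ∀ {m m′} xs → m ≤ m′ → Partition≤ m xs → Partition≤ m′ xs
Partition≤-weaken []       _    _                 = tt
Partition≤-weaken (x ∷ xs) m≤m′ (1≤x , x≤m , xs↓) = 1≤x , ≤-trans x≤m m≤m′ , xs↓

Partition≤-sum : ∀ {m} xs → Partition≤ m xs → Partition≤ (sum xs) xs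
Partition≤-sum []       _                = tt
Partition≤-sum (x ∷ xs) (1≤x , _ , xs↓) = 1≤x , m≤m+n x (sum xs) , xs↓

reverseAcc-ascending : ∀ {p} μ acc → Ascending p μ → Partition≤ p acc → 1 ≤ p →
                       ∃ λ m → Partition≤ m (reverseAcc acc μ)
reverseAcc-ascending {p} []      acc _           acc↓ _   = p , acc↓
reverseAcc-ascending     (x ∷ μ) acc (p≤x , μ↑) acc↓ 1≤p =
  reverseAcc-ascending μ (x ∷ acc) μ↑ (1≤x , ≤-refl , Partition≤-weaken acc p≤x acc↓) 1≤x
  where 1≤x = ≤-trans 1≤p p≤x

reverseAcc-partition : ∀ {m} λ′ acc → Partition≤ m λ′ → Ascending m acc → 1 ≤ m →
                       Ascending 1 (reverseAcc acc λ′)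
reverseAcc-partition []       acc _                  acc↑ 1≤m = Ascending-weaken acc 1≤m acc↑
reverseAcc-partition (x ∷ xs) acc (1≤x , x≤m , xs↓) acc↑ _   =
  reverseAcc-partition xs (x ∷ acc) xs↓ (≤-refl , Ascending-weaken acc x≤m acc↑) 1≤x

partsLE-sound : ∀ f n m {λ′} → λ′ ∈ partsLE f n m → Partition≤ m λ′ × sum λ′ ≡ n
partsLE-sound f       zero    m (here refl) = tt , refl
partsLE-sound (suc f) (suc n) m λ∈
  with k , k∈ , λ∈′ ← ∈-concatMap⁻′ (λ k → map (suc k ∷_) (partsLE f (suc n ∸ suc k) (suc k)))
                                     (upTo (suc n ⊓ m)) λ∈
  with xs , xs∈ , refl ← ∈-map⁻ (suc k ∷_) λ∈′
  with xs↓ , Σxs ← partsLE-sound f (n ∸ k) (suc k) xs∈ =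
    (s≤s z≤n , ≤-trans k< (m⊓n≤n (suc n) m) , xs↓) ,
    trans (cong (suc k +_) Σxs) (cong suc (m+[n∸m]≡n (≤-pred (≤-trans k< (m⊓n≤m (suc n) m)))))
  where
  k< : suc k ≤ suc n ⊓ m
  k< = ∈-upTo⁻ k∈

∈-partsLE : ∀ f n m λ′ → Partition≤ m λ′ → sum λ′ ≡ n → n ≤ f → λ′ ∈ partsLE f n m
∈-partsLE f       zero    m []       _             _    _ = here refl
∈-partsLE f       zero    m (x ∷ xs) (1≤x , _)     Σ≡0  _ =
  ⊥-elim (1+n≰n (≤-trans 1≤x (≤-trans (m≤m+n x (sum xs)) (≤-reflexive Σ≡0))))
∈-partsLE (suc f) (suc n) m (suc k ∷ xs) (_ , x≤m , xs↓) Σ≡n (s≤s n≤f) =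
  ∈-concatMap⁺′ (∈-upTo⁺ (⊓-glb k<sn x≤m))
    (∈-map⁺ (suc k ∷_) (∈-partsLE f (n ∸ k) (suc k) xs xs↓ Σxs (≤-trans (m∸n≤m n k) n≤f)))
  where
  k<sn : suc k ≤ suc n
  k<sn = ≤-trans (m≤m+n (suc k) (sum xs)) (≤-reflexive Σ≡n)
  Σxs : sum xs ≡ n ∸ k
  Σxs = trans (sym (m+n∸m≡n k (sum xs))) (cong (_∸ k) (suc-injective Σ≡n))

partsLE-unique : ∀ f n m → Unique (partsLE f n m)
partsLE-unique f       zero    m = [] ∷ []
partsLE-unique zero    (suc n) m = []
partsLE-unique (suc f) (suc n) m =
  concatMap-unique _ (Unique.upTo⁺ (suc n ⊓ m))
    (λ k → Unique.map⁺ ∷-injectiveʳ (partsLE-unique f (suc n ∸ suc k) (suc k)))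
    λ p q → head≡ (∈-map⁻ _ p) (∈-map⁻ _ q)
  where
  head≡ : ∀ {k k′ y} {L L′ : List (List ℕ)} →
          ∃ (λ xs → xs ∈ L × y ≡ suc k ∷ xs) → ∃ (λ xs → xs ∈ L′ × y ≡ suc k′ ∷ xs) → k ≡ k′
  head≡ (_ , _ , refl) (_ , _ , refl) = refl

rowsOf-ascending : ∀ c w → Ascending c (rowsOf c w)
rowsOf-ascending c []           = tt
rowsOf-ascending c (true  ∷ w) = Ascending-weaken (rowsOf (suc c) w) (n≤1+n c) (rowsOf-ascending (suc c) w)
rowsOf-ascending c (false ∷ w) = ≤-refl , rowsOf-ascending c w

length-rowsOf : ∀ c w → length (rowsOf c w) ≡ zeros w
length-rowsOf c []           = refl
length-rowsOf c (true  ∷ w) = length-rowsOf (suc c) w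
length-rowsOf c (false ∷ w) = cong suc (length-rowsOf c w)

rowsOf-≤ : ∀ c w → All (_≤ c + ones w) (rowsOf c w)
rowsOf-≤ c []           = []
rowsOf-≤ c (true  ∷ w) = subst (λ b → All (_≤ b) (rowsOf (suc c) w)) (sym (+-suc c (ones w))) (rowsOf-≤ (suc c) w)
rowsOf-≤ c (false ∷ w) = m≤m+n c (ones w) ∷ rowsOf-≤ c w

rowsOf-replicate : ∀ c k w → rowsOf c (replicate k true ++ w) ≡ rowsOf (c + k) w
rowsOf-replicate c zero    w = cong (λ j → rowsOf j w) (sym (+-identityʳ c))
rowsOf-replicate c (suc k) w = trans (rowsOf-replicate (suc c) k w) (cong (λ j → rowsOf j w) (sym (+-suc c k)))

rowsOf-pathFrom : ∀ p μ → Ascending p μ → rowsOf p (pathFrom p μ) ≡ μ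
rowsOf-pathFrom p []      _           = refl
rowsOf-pathFrom p (x ∷ μ) (p≤x , μ↑) = begin
  rowsOf p (replicate (x ∸ p) true ++ false ∷ pathFrom x μ)  ≡⟨ rowsOf-replicate p (x ∸ p) _ ⟩
  rowsOf (p + (x ∸ p)) (false ∷ pathFrom x μ)
    ≡⟨ cong (λ j → rowsOf j (false ∷ pathFrom x μ)) (m+[n∸m]≡n p≤x) ⟩
  x ∷ rowsOf x (pathFrom x μ)                                ≡⟨ cong (x ∷_) (rowsOf-pathFrom x μ μ↑) ⟩
  x ∷ μ                                                      ∎
  where open ≡-Reasoning

replicate-suc-++ : ∀ {A : Set} {x : A} k {r} → replicate (suc k) x ++ r ≡ replicate k x ++ x ∷ r
replicate-suc-++ zero    = refl
replicate-suc-++ {x = x} (suc k) = cong (x ∷_) (replicate-suc-++ k)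

pathFrom-rowsOf : ∀ p c v → p ≤ c → pathFrom p (rowsOf c (v ++ [ false ])) ≡ replicate (c ∸ p) true ++ v ++ [ false ]
pathFrom-rowsOf p c []          p≤c = refl
pathFrom-rowsOf p c (true  ∷ v) p≤c = begin
  pathFrom p (rowsOf (suc c) (v ++ [ false ]))         ≡⟨ pathFrom-rowsOf p (suc c) v (≤-trans p≤c (n≤1+n c)) ⟩
  replicate (suc c ∸ p) true ++ v ++ [ false ]
    ≡⟨ cong (λ j → replicate j true ++ v ++ [ false ]) (+-∸-assoc 1 p≤c) ⟩
  replicate (suc (c ∸ p)) true ++ v ++ [ false ]       ≡⟨ replicate-suc-++ (c ∸ p) ⟩
  replicate (c ∸ p) true ++ true ∷ v ++ [ false ]      ∎
  where open ≡-Reasoning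
pathFrom-rowsOf p c (false ∷ v) p≤c =
  cong (λ r → replicate (c ∸ p) true ++ false ∷ r)
    (trans (pathFrom-rowsOf c c v ≤-refl) (cong (λ j → replicate j true ++ v ++ [ false ]) (n∸n≡0 c)))

B-boundary : ∀ λ′ v → boundary λ′ ≡ true ∷ v ++ [ false ] → B λ′ ≡ v
B-boundary λ′ v bd rewrite bd | length-++ v {[ false ]} | +-comm (length v) 1 = take-length v
  where
  take-length : ∀ v → take (length v) (v ++ [ false ]) ≡ v
  take-length []      = refl
  take-length (x ∷ v) = cong (x ∷_) (take-length v)

B-P : ∀ C → B (P C) ≡ C
B-P C = B-boundary (P C) C
  (trans (cong (pathFrom 0) (reverse-involutive (rowsOf 1 (C ++ [ false ]))))
         (pathFrom-rowsOf 0 0 (true ∷ C) z≤n))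

false∷pathFrom-snoc : ∀ q μ → ∃ λ v → false ∷ pathFrom q μ ≡ v ++ [ false ]
false∷pathFrom-snoc q []      = [] , refl
false∷pathFrom-snoc q (z ∷ μ) =
  let v , eq = false∷pathFrom-snoc z μ in
  false ∷ replicate (z ∸ q) true ++ v ,
  cong (false ∷_) (trans (cong (replicate (z ∸ q) true ++_) eq) (sym (++-assoc (replicate (z ∸ q) true) v _)))

pathFrom-boundary-shape : ∀ μ → Ascending 1 μ → μ ≢ [] → ∃ λ v → pathFrom 0 μ ≡ true ∷ v ++ [ false ]
pathFrom-boundary-shape []            _           μ≢[] = ⊥-elim (μ≢[] refl)
pathFrom-boundary-shape (suc y ∷ μ) (s≤s _ , _) _    =
  let v , eq = false∷pathFrom-snoc (suc y) μ in
  replicate y true ++ v ,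
  cong (true ∷_) (trans (cong (replicate y true ++_) eq) (sym (++-assoc (replicate y true) v _)))

P-B : ∀ {m} λ′ → Partition≤ m λ′ → 1 ≤ m → λ′ ≢ [] → P (B λ′) ≡ λ′
P-B λ′ λ↓ 1≤m λ≢[] = begin
  P (B λ′)                                      ≡⟨ cong P (B-boundary λ′ v bd) ⟩
  reverse (rowsOf 0 (true ∷ v ++ [ false ]))    ≡⟨ cong (reverse ∘ rowsOf 0) bd ⟨
  reverse (rowsOf 0 (pathFrom 0 (reverse λ′)))
    ≡⟨ cong reverse (rowsOf-pathFrom 0 (reverse λ′) (Ascending-weaken _ z≤n μ↑)) ⟩
  reverse (reverse λ′)                          ≡⟨ reverse-involutive λ′ ⟩
  λ′                                            ∎
  where
  open ≡-Reasoning
  μ↑ : Ascending 1 (reverse λ′)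
  μ↑ = reverseAcc-partition λ′ [] λ↓ tt 1≤m
  μ≢[] : reverse λ′ ≢ []
  μ≢[] eq = λ≢[] (trans (sym (reverse-involutive λ′)) (cong reverse eq))
  v = proj₁ (pathFrom-boundary-shape (reverse λ′) μ↑ μ≢[])
  bd = proj₂ (pathFrom-boundary-shape (reverse λ′) μ↑ μ≢[])

sum-rowsOf : ∀ c w → sum (rowsOf c w) ≡ c * zeros w + inv w
sum-rowsOf c []           = sym (trans (+-identityʳ _) (*-zeroʳ c))
sum-rowsOf c (true  ∷ w) = trans (sum-rowsOf (suc c) w)
  (solve 3 (λ c z i → (con 1 :+ c) :* z :+ i := c :* z :+ (z :+ i)) refl c (zeros w) (inv w))
sum-rowsOf c (false ∷ w) = trans (cong (c +_) (sum-rowsOf c w))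
  (solve 3 (λ c z i → c :+ (c :* z :+ i) := c :* (con 1 :+ z) :+ i) refl c (zeros w) (inv w))

size-P : ∀ C → size (P C) ≡ inv C + ones C + zeros C + 1
size-P C = begin
  sum (reverse (rowsOf 1 (C ++ [ false ])))         ≡⟨ sum-↭ (↭-reverse (rowsOf 1 (C ++ [ false ]))) ⟩
  sum (rowsOf 1 (C ++ [ false ]))                   ≡⟨ sum-rowsOf 1 (C ++ [ false ]) ⟩
  1 * zeros (C ++ [ false ]) + inv (C ++ [ false ])
    ≡⟨ cong₂ (λ z i → 1 * z + i) (zeros-++ C [ false ]) (inv-++ C [ false ]) ⟩
  1 * (zeros C + 1) + (inv C + ones C * 1 + 0)
    ≡⟨ solve 3 (λ z i o → con 1 :* (z :+ con 1) :+ (i :+ o :* con 1 :+ con 0) := i :+ o :+ z :+ con 1)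
               refl (zeros C) (inv C) (ones C) ⟩
  inv C + ones C + zeros C + 1                      ∎
  where open ≡-Reasoning

ones<size-P : ∀ C → ones C < size (P C)
ones<size-P C = begin-strict
  ones C                        ≤⟨ m≤n+m (ones C) (inv C) ⟩
  inv C + ones C                ≤⟨ m≤m+n _ (zeros C) ⟩
  inv C + ones C + zeros C      <⟨ m<m+n _ z<s ⟩
  inv C + ones C + zeros C + 1  ≡⟨ size-P C ⟨
  size (P C)                    ∎
  where open ≤-Reasoning

zeros<size-P : ∀ C → zeros C < size (P C)
zeros<size-P C = begin-strict
  zeros C                       ≤⟨ m≤n+m (zeros C) (inv C + ones C) ⟩
  inv C + ones C + zeros C      <⟨ m<m+n _ z<s ⟩
  inv C + ones C + zeros C + 1  ≡⟨ size-P C ⟨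
  size (P C)                    ∎
  where open ≤-Reasoning

P-partition : ∀ C → Partition≤ (size (P C)) (P C)
P-partition C =
  let _ , P↓ = reverseAcc-ascending (rowsOf 1 (C ++ [ false ])) [] (rowsOf-ascending 1 (C ++ [ false ])) tt (s≤s z≤n) in
  Partition≤-sum (P C) P↓

bothSizes : ℕ → List Bool → Bool
bothSizes n C = does (size (P C) ≟ n) ∧ does (size (P (reverse C)) ≟ n)

R-suc≡count-bothSizes : ∀ m N → suc m ≤ N → R (suc m) ≡ count (bothSizes (suc m)) (wordsBelow N)
R-suc≡count-bothSizes m N n≤N =
  count-bijection _ _ (partsLE-unique n n n) (wordsBelow-unique N) B P to from
  where
  n = suc m
  to : ∀ {λ′} → λ′ ∈ partitions n → Bool.T (does (size (P (reverse (B λ′))) ≟ n)) →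
       (B λ′ ∈ wordsBelow N × Bool.T (bothSizes n (B λ′))) × P (B λ′) ≡ λ′
  to {λ′} λ∈ rev-ok =
    let λ↓ , Σλ≡n = partsLE-sound n n n λ∈
        PB≡λ = P-B λ′ λ↓ (s≤s z≤n) λ≢[]
        size≡n = trans (cong size PB≡λ) Σλ≡n
        size≤N = subst (_≤ N) (sym size≡n) n≤N in
    ( ∈-wordsBelow N (B λ′) (<-≤-trans (ones<size-P (B λ′)) size≤N) (<-≤-trans (zeros<size-P (B λ′)) size≤N)
    , Equivalence.from T-∧ (≡⇒≡ᵇ (size (P (B λ′))) n size≡n , rev-ok) )
    , PB≡λ
    where
    λ≢[] : λ′ ≢ []
    λ≢[] refl = 1+n≢0 (sym (proj₂ (partsLE-sound n n n λ∈)))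
  from : ∀ {C} → C ∈ wordsBelow N → Bool.T (bothSizes n C) →
         (P C ∈ partitions n × Bool.T (does (size (P (reverse (B (P C)))) ≟ n))) × B (P C) ≡ C
  from {C} _ ok =
    let size-ok , rev-ok = Equivalence.to T-∧ ok
        size≡n = ≡ᵇ⇒≡ (size (P C)) n size-ok in
    ( ∈-partsLE n n n (P C) (subst (λ s → Partition≤ s (P C)) size≡n (P-partition C)) size≡n ≤-refl
    , subst (λ D → Bool.T (does (size (P (reverse D)) ≟ n))) (sym (B-P C)) rev-ok )
    , B-P C

-- Nondecreasing sequences as words

natSeqs : ℕ → ℕ → List (List ℕ)
natSeqs zero    K = [ [] ]
natSeqs (suc n) K = concatMap (λ i → map (i ∷_) (natSeqs n K)) (upTo (suc K))

natSeqs-sound : ∀ n K {ys} → ys ∈ natSeqs n K → length ys ≡ n × All (_≤ K) ys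
natSeqs-sound zero    K (here refl) = refl , []
natSeqs-sound (suc n) K ys∈
  with i , i∈ , ys∈′ ← ∈-concatMap⁻′ (λ i → map (i ∷_) (natSeqs n K)) (upTo (suc K)) ys∈
  with zs , zs∈ , refl ← ∈-map⁻ (i ∷_) ys∈′ =
    let len , zs≤K = natSeqs-sound n K zs∈ in cong suc len , ≤-pred (∈-upTo⁻ i∈) ∷ zs≤K

∈-natSeqs : ∀ {n K} ys → length ys ≡ n → All (_≤ K) ys → ys ∈ natSeqs n K
∈-natSeqs []       refl []           = here refl
∈-natSeqs (y ∷ ys) refl (y≤K ∷ ys≤K) =
  ∈-concatMap⁺′ (∈-upTo⁺ (s≤s y≤K)) (∈-map⁺ (y ∷_) (∈-natSeqs ys refl ys≤K))

natSeqs-unique : ∀ n K → Unique (natSeqs n K)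
natSeqs-unique zero    K = [] ∷ []
natSeqs-unique (suc n) K =
  concatMap-unique _ (Unique.upTo⁺ (suc K)) (λ i → Unique.map⁺ ∷-injectiveʳ (natSeqs-unique n K))
    λ p q → head≡ (∈-map⁻ _ p) (∈-map⁻ _ q)
  where
  head≡ : ∀ {i i′ ys} {L L′ : List (List ℕ)} →
          ∃ (λ zs → zs ∈ L × ys ≡ i ∷ zs) → ∃ (λ zs → zs ∈ L′ × ys ≡ i′ ∷ zs) → i ≡ i′
  head≡ (_ , _ , refl) (_ , _ , refl) = refl

shift : ℕ → ℕ → ℤ
shift k i = ℤ.+ i ℤ.- ℤ.+ k

seqs≡map-shift : ∀ n k → seqs n k ≡ map (map (shift k)) (natSeqs n (k + k))
seqs≡map-shift zero    k = refl
seqs≡map-shift (suc n) k = begin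
  concatMap (λ x → map (x ∷_) (seqs n k)) (map (shift k) U)               ≡⟨ concatMap-map _ (shift k) U ⟩
  concatMap (λ i → map (shift k i ∷_) (seqs n k)) U                        ≡⟨ concatMap-cong step U ⟩
  concatMap (λ i → map (map (shift k)) (map (i ∷_) (natSeqs n (k + k)))) U ≡⟨ map-concatMap (map (shift k)) _ U ⟨
  map (map (shift k)) (natSeqs (suc n) (k + k))                            ∎
  where
  open ≡-Reasoning
  U = upTo (suc (k + k))
  step : ∀ i → map (shift k i ∷_) (seqs n k) ≡ map (map (shift k)) (map (i ∷_) (natSeqs n (k + k)))
  step i = trans (cong (map (shift k i ∷_)) (seqs≡map-shift n k))
                 (trans (sym (map-∘ (natSeqs n (k + k)))) (map-∘ (natSeqs n (k + k))))

shift-mono-≤ : ∀ k {x y} → x ≤ y → shift k x ℤ.≤ shift k y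
shift-mono-≤ k x≤y = ℤ.+-monoˡ-≤ (ℤ.- ℤ.+ k) (ℤ.+≤+ x≤y)

shift-cancel-≤ : ∀ k {x y} → shift k x ℤ.≤ shift k y → x ≤ y
shift-cancel-≤ k {x} {y} le = ℤ.drop‿+≤+ (subst₂ ℤ._≤_ (unshift x) (unshift y) (ℤ.+-monoˡ-≤ (ℤ.+ k) le))
  where
  unshift : ∀ x → shift k x ℤ.+ ℤ.+ k ≡ ℤ.+ x
  unshift x = trans (ℤ.+-assoc (ℤ.+ x) (ℤ.- ℤ.+ k) (ℤ.+ k))
                    (trans (cong (λ i → ℤ.+ x ℤ.+ i) (ℤ.+-inverseˡ (ℤ.+ k))) (ℤ.+-identityʳ _))

does-shift-≤ : ∀ k x y → does (shift k x ℤ.≤? shift k y) ≡ (x ≤ᵇ y)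
does-shift-≤ k x y = does-⇔ (mk⇔ (shift-cancel-≤ k) (shift-mono-≤ k)) (shift k x ℤ.≤? shift k y) (x ≤? y)

ascending⇒nondecᵇ : ∀ k {p} ys → Ascending p ys → Bool.T (nondecᵇ (map (shift k) ys))
ascending⇒nondecᵇ k []           _                = tt
ascending⇒nondecᵇ k (x ∷ [])     _                = tt
ascending⇒nondecᵇ k (x ∷ y ∷ ys) (_ , x≤y , ys↑) =
  subst (λ b → Bool.T (b ∧ _)) (sym (does-shift-≤ k x y))
    (Equivalence.from T-∧ (≤⇒≤ᵇ x≤y , ascending⇒nondecᵇ k (y ∷ ys) (x≤y , ys↑)))

nondecᵇ⇒ascending : ∀ k ys → Bool.T (nondecᵇ (map (shift k) ys)) → Ascending 0 ys
nondecᵇ⇒ascending k []           _  = tt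
nondecᵇ⇒ascending k (x ∷ [])     _  = z≤n , tt
nondecᵇ⇒ascending k (x ∷ y ∷ ys) ok =
  let x≤y , rest = Equivalence.to T-∧ (subst (λ b → Bool.T (b ∧ _)) (does-shift-≤ k x y) ok) in
  z≤n , ≤ᵇ⇒≤ x y x≤y , proj₂ (nondecᵇ⇒ascending k (y ∷ ys) rest)

sumℤ-shift : ∀ k ys → sumℤ (map (shift k) ys) ≡ ℤ.+ sum ys ℤ.- ℤ.+ (length ys * k)
sumℤ-shift k []       = refl
sumℤ-shift k (y ∷ ys) = begin
  (ℤ.+ y ℤ.- ℤ.+ k) ℤ.+ sumℤ (map (shift k) ys)
    ≡⟨ cong (λ i → shift k y ℤ.+ i) (sumℤ-shift k ys) ⟩
  (ℤ.+ y ℤ.- ℤ.+ k) ℤ.+ (ℤ.+ sum ys ℤ.- ℤ.+ (length ys * k))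
    ≡⟨ interchange (ℤ.+ y) (ℤ.- ℤ.+ k) (ℤ.+ sum ys) _ ⟩
  (ℤ.+ y ℤ.+ ℤ.+ sum ys) ℤ.+ (ℤ.- ℤ.+ k ℤ.+ ℤ.- ℤ.+ (length ys * k))
    ≡⟨ cong₂ ℤ._+_ (ℤ.pos-+ y (sum ys)) (ℤ.neg-distrib-+ (ℤ.+ k) _) ⟨
  ℤ.+ (y + sum ys) ℤ.- (ℤ.+ k ℤ.+ ℤ.+ (length ys * k))
    ≡⟨ cong (λ i → ℤ.+ (y + sum ys) ℤ.- i) (ℤ.pos-+ k (length ys * k)) ⟨
  ℤ.+ (y + sum ys) ℤ.- ℤ.+ (k + length ys * k)
    ∎
  where open ≡-Reasoning

does-sumℤ-shift : ∀ k ys → does (sumℤ (map (shift k) ys) ℤ.≟ ℤ.+ 0) ≡ does (sum ys ≟ length ys * k)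
does-sumℤ-shift k ys = does-⇔ (mk⇔ to from) (sumℤ (map (shift k) ys) ℤ.≟ ℤ.+ 0) (sum ys ≟ length ys * k)
  where
  to : sumℤ (map (shift k) ys) ≡ ℤ.+ 0 → sum ys ≡ length ys * k
  to eq = ℤ.+-injective (ℤ.i-j≡0⇒i≡j _ _ (trans (sym (sumℤ-shift k ys)) eq))
  from : sum ys ≡ length ys * k → sumℤ (map (shift k) ys) ≡ ℤ.+ 0
  from eq = trans (sumℤ-shift k ys) (ℤ.i≡j⇒i-j≡0 (cong ℤ.+_ eq))

encode : ℕ → ℕ → List ℕ → List Bool
encode p t []       = replicate (t ∸ p) true
encode p t (y ∷ ys) = replicate (y ∸ p) true ++ false ∷ encode y t ys

ones-replicate-++ : ∀ j w → ones (replicate j true ++ w) ≡ j + ones w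
ones-replicate-++ zero    w = refl
ones-replicate-++ (suc j) w = cong suc (ones-replicate-++ j w)

zeros-replicate-++ : ∀ j w → zeros (replicate j true ++ w) ≡ zeros w
zeros-replicate-++ zero    w = refl
zeros-replicate-++ (suc j) w = zeros-replicate-++ j w

zeros-encode : ∀ p t ys → zeros (encode p t ys) ≡ length ys
zeros-encode p t []       = trans (cong zeros (sym (++-identityʳ (replicate (t ∸ p) true)))) (zeros-replicate-++ (t ∸ p) [])
zeros-encode p t (y ∷ ys) = trans (zeros-replicate-++ (y ∸ p) _) (cong suc (zeros-encode y t ys))

ones-encode : ∀ p t ys → Ascending p ys → All (_≤ t) ys → ones (encode p t ys) ≡ t ∸ p
ones-encode p t []       _          _ =
  trans (cong ones (sym (++-identityʳ (replicate (t ∸ p) true)))) (trans (ones-replicate-++ (t ∸ p) []) (+-identityʳ _))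
ones-encode p t (y ∷ ys) (p≤y , ys↑) (y≤t ∷ ys≤t) = begin
  ones (replicate (y ∸ p) true ++ false ∷ encode y t ys) ≡⟨ ones-replicate-++ (y ∸ p) _ ⟩
  (y ∸ p) + ones (encode y t ys)                        ≡⟨ cong ((y ∸ p) +_) (ones-encode y t ys ys↑ ys≤t) ⟩
  (y ∸ p) + (t ∸ y)                                     ≡⟨ +-comm (y ∸ p) (t ∸ y) ⟩
  (t ∸ y) + (y ∸ p)                                     ≡⟨ +-∸-assoc (t ∸ y) p≤y ⟨
  (t ∸ y) + y ∸ p                                       ≡⟨ cong (_∸ p) (m∸n+n≡m y≤t) ⟩
  t ∸ p                                                 ∎
  where open ≡-Reasoning

rowsOf-encode : ∀ p t ys → Ascending p ys → rowsOf p (encode p t ys) ≡ ys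
rowsOf-encode p t []       _ =
  trans (cong (rowsOf p) (sym (++-identityʳ (replicate (t ∸ p) true)))) (rowsOf-replicate p (t ∸ p) [])
rowsOf-encode p t (y ∷ ys) (p≤y , ys↑) = begin
  rowsOf p (replicate (y ∸ p) true ++ false ∷ encode y t ys)  ≡⟨ rowsOf-replicate p (y ∸ p) _ ⟩
  rowsOf (p + (y ∸ p)) (false ∷ encode y t ys)
    ≡⟨ cong (λ j → rowsOf j (false ∷ encode y t ys)) (m+[n∸m]≡n p≤y) ⟩
  y ∷ rowsOf y (encode y t ys)                                ≡⟨ cong (y ∷_) (rowsOf-encode y t ys ys↑) ⟩
  y ∷ ys                                                      ∎
  where open ≡-Reasoning

encode-rowsOf : ∀ p c w → p ≤ c → encode p (c + ones w) (rowsOf c w) ≡ replicate (c ∸ p) true ++ w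
encode-rowsOf p c []           _   =
  trans (cong (λ j → replicate (j ∸ p) true) (+-identityʳ c)) (sym (++-identityʳ (replicate (c ∸ p) true)))
encode-rowsOf p c (true  ∷ w) p≤c = begin
  encode p (c + suc (ones w)) (rowsOf (suc c) w)  ≡⟨ cong (λ t → encode p t (rowsOf (suc c) w)) (+-suc c (ones w)) ⟩
  encode p (suc c + ones w) (rowsOf (suc c) w)    ≡⟨ encode-rowsOf p (suc c) w (≤-trans p≤c (n≤1+n c)) ⟩
  replicate (suc c ∸ p) true ++ w                 ≡⟨ cong (λ j → replicate j true ++ w) (+-∸-assoc 1 p≤c) ⟩
  replicate (suc (c ∸ p)) true ++ w               ≡⟨ replicate-suc-++ (c ∸ p) ⟩
  replicate (c ∸ p) true ++ true ∷ w              ∎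
  where open ≡-Reasoning
encode-rowsOf p c (false ∷ w) _   =
  cong (λ r → replicate (c ∸ p) true ++ false ∷ r)
    (trans (encode-rowsOf c c w ≤-refl) (cong (λ j → replicate j true ++ w) (n∸n≡0 c)))

T≡gaussian : ∀ m k → T m k ≡ gaussian (2 * k) m (m * k)
T≡gaussian m k = begin
  T m k
    ≡⟨ cong (count zeroSum) (seqs≡map-shift m k) ⟩
  count zeroSum (map (map (shift k)) (natSeqs m K))
    ≡⟨ count-map zeroSum (map (shift k)) (natSeqs m K) ⟩
  count (zeroSum ∘ map (shift k)) (natSeqs m K)
    ≡⟨ count-bijection _ _ (natSeqs-unique m K) (words-unique K m) (encode 0 K) (rowsOf 0) to from ⟩
  gaussian K m (m * k)
    ≡⟨ cong (λ K → gaussian K m (m * k)) (cong (k +_) (+-identityʳ k)) ⟨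
  gaussian (2 * k) m (m * k)
    ∎
  where
  open ≡-Reasoning
  K = k + k
  zeroSum : List ℤ → Bool
  zeroSum xs = nondecᵇ xs ∧ does (sumℤ xs ℤ.≟ ℤ.+ 0)
  to : ∀ {ys} → ys ∈ natSeqs m K → Bool.T (zeroSum (map (shift k) ys)) →
       (encode 0 K ys ∈ words K m × Bool.T (does (inv (encode 0 K ys) ≟ m * k))) × rowsOf 0 (encode 0 K ys) ≡ ys
  to {ys} ys∈ ok =
    let len≡m , ys≤K = natSeqs-sound m K ys∈
        nondec , sum-ok = Equivalence.to T-∧ ok
        ys↑ = nondecᵇ⇒ascending k ys nondec
        rows≡ys = rowsOf-encode 0 K ys ys↑
        Σys≡ = ≡ᵇ⇒≡ (sum ys) (length ys * k) (subst Bool.T (does-sumℤ-shift k ys) sum-ok) in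
    ( ∈-words′ (encode 0 K ys) (ones-encode 0 K ys ys↑ ys≤K) (trans (zeros-encode 0 K ys) len≡m)
    , ≡⇒≡ᵇ (inv (encode 0 K ys)) (m * k)
        (trans (sym (sum-rowsOf 0 (encode 0 K ys))) (trans (cong sum rows≡ys) (trans Σys≡ (cong (_* k) len≡m)))) )
    , rows≡ys
  from : ∀ {w} → w ∈ words K m → Bool.T (does (inv w ≟ m * k)) →
         (rowsOf 0 w ∈ natSeqs m K × Bool.T (zeroSum (map (shift k) (rowsOf 0 w)))) × encode 0 K (rowsOf 0 w) ≡ w
  from {w} w∈ inv-ok =
    let ones≡K , zeros≡m = words-sound K m w∈
        len≡m = trans (length-rowsOf 0 w) zeros≡m
        Σrows≡ = trans (sum-rowsOf 0 w) (≡ᵇ⇒≡ (inv w) (m * k) inv-ok) in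
    ( ∈-natSeqs (rowsOf 0 w) len≡m (subst (λ b → All (_≤ b) (rowsOf 0 w)) ones≡K (rowsOf-≤ 0 w))
    , Equivalence.from T-∧
        ( ascending⇒nondecᵇ k (rowsOf 0 w) (rowsOf-ascending 0 w)
        , subst Bool.T (sym (does-sumℤ-shift k (rowsOf 0 w)))
            (≡⇒≡ᵇ (sum (rowsOf 0 w)) (length (rowsOf 0 w) * k) (trans Σrows≡ (cong (_* k) (sym len≡m)))) ) )
    , subst (λ t → encode 0 t (rowsOf 0 w) ≡ w) ones≡K (encode-rowsOf 0 0 w z≤n)

-- Splitting by parity

size-P-reverse : ∀ C → size (P (reverse C)) ≡ coinv C + ones C + zeros C + 1
size-P-reverse C rewrite size-P (reverse C) | inv-reverse C | ones-reverse C | zeros-reverse C = refl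

sizes-equal⇒inv≡coinv : ∀ C → size (P C) ≡ size (P (reverse C)) → inv C ≡ coinv C
sizes-equal⇒inv≡coinv C eq =
  +-cancelʳ-≡ (ones C) _ _ (+-cancelʳ-≡ (zeros C) _ _ (+-cancelʳ-≡ 1 _ _
    (trans (sym (size-P C)) (trans eq (size-P-reverse C)))))

inv≡coinv⇒2*inv : ∀ C → inv C ≡ coinv C → 2 * inv C ≡ ones C * zeros C
inv≡coinv⇒2*inv C eq = trans (cong (inv C +_) (trans (+-identityʳ (inv C)) eq)) (inv+coinv C)

bothSizes-even : ∀ n a b t C → ones C ≡ a → zeros C ≡ b → 2 * t ≡ a * b →
                 bothSizes n C ≡ does (inv C ≟ t) ∧ does (t + a + b + 1 ≟ n)
bothSizes-even n _ _ t C refl refl 2t≡ =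
  does-⇔ (mk⇔ to from) ((size (P C) ≟ n) ×-dec (size (P (reverse C)) ≟ n))
                       ((inv C ≟ t) ×-dec (t + ones C + zeros C + 1 ≟ n))
  where
  size[_] : ℕ → ℕ
  size[ i ] = i + ones C + zeros C + 1
  to : size (P C) ≡ n × size (P (reverse C)) ≡ n → inv C ≡ t × size[ t ] ≡ n
  to (s≡n , s′≡n) =
    let inv≡coinv = sizes-equal⇒inv≡coinv C (trans s≡n (sym s′≡n))
        inv≡t = *-cancelˡ-≡ _ _ 2 (trans (inv≡coinv⇒2*inv C inv≡coinv) (sym 2t≡)) in
    inv≡t , trans (cong size[_] (sym inv≡t)) (trans (sym (size-P C)) s≡n)
  from : inv C ≡ t × size[ t ] ≡ n → size (P C) ≡ n × size (P (reverse C)) ≡ n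
  from (inv≡t , e) = trans (size-P C) (trans (cong size[_] inv≡t) e) ,
                     trans (size-P-reverse C) (trans (cong size[_] coinv≡t) e)
    where
    coinv≡t : coinv C ≡ t
    coinv≡t = +-cancelˡ-≡ t _ _ (trans (cong (_+ coinv C) (sym inv≡t))
                (trans (inv+coinv C) (trans (sym 2t≡) (cong (t +_) (+-identityʳ t)))))

bothSizes-odd : ∀ n C → (∀ t → 2 * t ≢ ones C * zeros C) → bothSizes n C ≡ false
bothSizes-odd n C odd = dec-false ((size (P C) ≟ n) ×-dec (size (P (reverse C)) ≟ n)) λ (s≡n , s′≡n) →
  odd (inv C) (inv≡coinv⇒2*inv C (sizes-equal⇒inv≡coinv C (trans s≡n (sym s′≡n))))

bothSizesCount : ℕ → ℕ → ℕ → ℕ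
bothSizesCount n a b = count (bothSizes n) (words a b)

bothSizesCount-gaussian : ∀ n a b t {e g} → 2 * t ≡ a * b → t + a + b + 1 ≡ e → gaussian a b t ≡ g →
                     bothSizesCount n a b ≡ term g n e
bothSizesCount-gaussian n a b t 2t≡ab refl refl =
  trans (count-cong _ _ (words a b) λ {C} C∈ → let o , z = words-sound a b C∈ in bothSizes-even n a b t C o z 2t≡ab)
        (count-∧-const _ (does (t + a + b + 1 ≟ n)) (words a b))

bothSizesCount-odd : ∀ n a b → (∀ t → 2 * t ≢ a * b) → bothSizesCount n a b ≡ 0
bothSizesCount-odd n a b odd =
  trans (count-cong _ _ (words a b) λ {C} C∈ → let o , z = words-sound a b C∈ in
           bothSizes-odd n C (subst₂ (λ a b → ∀ t → 2 * t ≢ a * b) (sym o) (sym z) odd))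
        (count-false (words a b))

2*m≢2*n+1 : ∀ m n → 2 * m ≢ 2 * n + 1
2*m≢2*n+1 m n eq with () ← ∣1⇒≡1 (∣m+n∣m⇒∣n (subst (2 ∣_) eq (m∣m*n m)) (m∣m*n n))

evenLengthTerm oddLengthTerm : ℕ → ℕ → ℕ → ℕ
evenLengthTerm n k l = term (T (2 * l) k) n (2 * k * l + 2 * k + 2 * l + 1)
oddLengthTerm  n k l = term (T (2 * k + 1) l) n (2 * k * l + 2 * k + 3 * l + 2)

rhsCoeff≡Σ< : ∀ n → rhsCoeff n ≡ Σ< (suc n) (λ k → Σ< (suc n) (evenLengthTerm n k))
                                 + 2 * Σ< (suc n) (λ k → Σ< (suc n) (oddLengthTerm n k))
rhsCoeff≡Σ< n = cong₂ (λ x y → x + 2 * y) (Σ≤²≡Σ<² (evenLengthTerm n)) (Σ≤²≡Σ<² (oddLengthTerm n))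
  where
  Σ≤²≡Σ<² : ∀ f → Σ≤ n (λ k → Σ≤ n (f k)) ≡ Σ< (suc n) (λ k → Σ< (suc n) (f k))
  Σ≤²≡Σ<² f = trans (Σ≤≡Σ< n _) (Σ<-cong (suc n) λ k → Σ≤≡Σ< n (f k))

bothSizesCount-even-even : ∀ n k l → bothSizesCount n (2 * k) (2 * l) ≡ evenLengthTerm n k l
bothSizesCount-even-even n k l =
  bothSizesCount-gaussian n (2 * k) (2 * l) (2 * l * k)
    (solve 2 (λ k l → con 2 :* (con 2 :* l :* k) := con 2 :* k :* (con 2 :* l)) refl k l)
    (solve 2 (λ k l → con 2 :* l :* k :+ con 2 :* k :+ con 2 :* l :+ con 1
              := con 2 :* k :* l :+ con 2 :* k :+ con 2 :* l :+ con 1) refl k l)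
    (sym (T≡gaussian (2 * l) k))

bothSizesCount-even-odd : ∀ n k l → bothSizesCount n (2 * k) (2 * l + 1) ≡ oddLengthTerm n l k
bothSizesCount-even-odd n k l =
  bothSizesCount-gaussian n (2 * k) (2 * l + 1) ((2 * l + 1) * k)
    (solve 2 (λ k l → con 2 :* ((con 2 :* l :+ con 1) :* k) := con 2 :* k :* (con 2 :* l :+ con 1)) refl k l)
    (solve 2 (λ k l → (con 2 :* l :+ con 1) :* k :+ con 2 :* k :+ (con 2 :* l :+ con 1) :+ con 1
              := con 2 :* l :* k :+ con 2 :* l :+ con 3 :* k :+ con 2) refl k l)
    (sym (T≡gaussian (2 * l + 1) k))

bothSizesCount-odd-even : ∀ n k l → bothSizesCount n (2 * k + 1) (2 * l) ≡ oddLengthTerm n k l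
bothSizesCount-odd-even n k l =
  bothSizesCount-gaussian n (2 * k + 1) (2 * l) ((2 * k + 1) * l)
    (solve 2 (λ k l → con 2 :* ((con 2 :* k :+ con 1) :* l) := (con 2 :* k :+ con 1) :* (con 2 :* l)) refl k l)
    (solve 2 (λ k l → (con 2 :* k :+ con 1) :* l :+ (con 2 :* k :+ con 1) :+ con 2 :* l :+ con 1
              := con 2 :* k :* l :+ con 2 :* k :+ con 3 :* l :+ con 2) refl k l)
    (trans (gaussian-sym (2 * k + 1) (2 * l) _) (sym (T≡gaussian (2 * k + 1) l)))

bothSizesCount-odd-odd : ∀ n k l → bothSizesCount n (2 * k + 1) (2 * l + 1) ≡ 0
bothSizesCount-odd-odd n k l = bothSizesCount-odd n (2 * k + 1) (2 * l + 1) λ t eq →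
  2*m≢2*n+1 t (2 * k * l + k + l)
    (trans eq (solve 2 (λ k l → (con 2 :* k :+ con 1) :* (con 2 :* l :+ con 1)
                                := con 2 :* (con 2 :* k :* l :+ k :+ l) :+ con 1) refl k l))

theorem5p3 : (n : ℕ) → R n ≡ rhsCoeff n
theorem5p3 zero    = refl
theorem5p3 (suc m) = begin
  R n
    ≡⟨ R-suc≡count-bothSizes m (2 * n′) (≤-trans (n≤1+n n) (m≤n*m n′ 2)) ⟩
  count (bothSizes n) (wordsBelow (2 * n′))
    ≡⟨ count-wordsBelow (bothSizes n) (2 * n′) ⟩
  Σ< (2 * n′) (λ a → Σ< (2 * n′) (c a))
    ≡⟨ Σ<-even-odd² n′ c ⟩
  Σ< n′ (λ k → Σ< n′ (λ l → c (2 * k) (2 * l) + c (2 * k) (2 * l + 1))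
             + Σ< n′ (λ l → c (2 * k + 1) (2 * l) + c (2 * k + 1) (2 * l + 1)))
    ≡⟨ Σ<-cong n′ (λ k → cong₂ _+_ (Σ<-cong n′ (even-row k)) (Σ<-cong n′ (odd-row k))) ⟩
  Σ< n′ (λ k → Σ< n′ (λ l → evenLengthTerm n k l + oddLengthTerm n l k) + Σ< n′ (oddLengthTerm n k))
    ≡⟨ Σ<-collect n′ (evenLengthTerm n) (oddLengthTerm n) ⟩
  Σ< n′ (λ k → Σ< n′ (evenLengthTerm n k)) + 2 * Σ< n′ (λ k → Σ< n′ (oddLengthTerm n k))
    ≡⟨ rhsCoeff≡Σ< n ⟨
  rhsCoeff n
    ∎
  where
  open ≡-Reasoning
  n = suc m
  n′ = suc n
  c = bothSizesCount n
  even-row : ∀ k l → c (2 * k) (2 * l) + c (2 * k) (2 * l + 1) ≡ evenLengthTerm n k l + oddLengthTerm n l k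
  even-row k l = cong₂ _+_ (bothSizesCount-even-even n k l) (bothSizesCount-even-odd n k l)
  odd-row : ∀ k l → c (2 * k + 1) (2 * l) + c (2 * k + 1) (2 * l + 1) ≡ oddLengthTerm n k l
  odd-row k l = trans (cong₂ _+_ (bothSizesCount-odd-even n k l) (bothSizesCount-odd-odd n k l)) (+-identityʳ _)
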